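{- If a finite graph $G$ is vertex transitive, then $\mu(H,G)=0$ for every graph $H$ with $|H|<|G|-1$.
   Context: $\mathcal{G}$ is the poset of all finite unlabelled graphs (loops and multiple edges allowed), up to isomorphism, with $H\le G$ iff $H$ is isomorphic to an induced subgraph of $G$; $|G|$ is the number of vertices. $\mu$ is its Möbius function: $\mu(a,a)=1$, $\mu(a,b)=0$ if $a\not\le b$, $\mu(a,b)=-\sum_{a\le c<b}\mu(a,c)$ if $a<b$. A graph is vertex transitive if for every pair of vertices $v_1,v_2$ there is an automorphism mapping $v_1$ to $v_2$. -}

module Defs where

open import Data.Nat using (ℕ; suc; _<_)
open import Data.Fin using (Fin)
open import Data.Integer using (ℤ; 0ℤ; 1ℤ; _+_; -_)
open import Data.List using (List; foldr; map)
open import Data.List.Relation.Unary.All using (All)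
open import Data.List.Relation.Unary.Any using (Any)
open import Data.List.Relation.Unary.AllPairs using (AllPairs)
open import Data.Product using (Σ; _×_; ∃)
open import Relation.Binary.PropositionalEquality using (_≡_)
open import Relation.Nullary using (¬_)
open import Function.Definitions using (Injective; Bijective)

-- A finite graph with loops and multiple edges allowed:
-- vertex set Fin n, adj i j = number of edges between i and j
-- (adj i i = number of loops at i).  Undirected: adj is symmetric.
record Graph : Set where
  field
    n   : ℕ
    adj : Fin n → Fin n → ℕ
    sym : ∀ i j → adj i j ≡ adj j i
open Graph public

∣_∣ : Graph → ℕ
∣ G ∣ = n G

Preserves : (H G : Graph) → (Fin (n H) → Fin (n G)) → Set
Preserves H G f = ∀ i j → adj G (f i) (f j) ≡ adj H i j

_≼_ : Graph → Graph → Set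
H ≼ G = Σ (Fin (n H) → Fin (n G)) λ f → Injective _≡_ _≡_ f × Preserves H G f

_≅_ : Graph → Graph → Set
H ≅ G = Σ (Fin (n H) → Fin (n G)) λ f → Bijective _≡_ _≡_ f × Preserves H G f

-- strict order on isomorphism classes: c ≤ b and c ≠ b (as classes)
_≺_ : Graph → Graph → Set
c ≺ b = c ≼ b × ¬ (c ≅ b)

VertexTransitive : Graph → Set
VertexTransitive G = ∀ (v₁ v₂ : Fin (n G)) →
  Σ (Fin (n G) → Fin (n G)) λ σ →
    Bijective _≡_ _≡_ σ × Preserves G G σ × σ v₁ ≡ v₂

IntervalReps : Graph → Graph → List Graph → Set
IntervalReps a b L =
  All (λ c → a ≼ c × c ≺ b) L ×
  (∀ c → a ≼ c → c ≺ b → Any (c ≅_) L) ×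
  AllPairs (λ x y → ¬ (x ≅ y)) L

sumℤ : List ℤ → ℤ
sumℤ = foldr _+_ 0ℤ

-- μ is the Möbius function of the poset 𝒢 (given on representatives):
--   μ(a,a) = 1, μ(a,b) = 0 if a ≰ b,
--   μ(a,b) = - Σ_{a ≤ c < b} μ(a,c)  (sum over isomorphism classes c).
IsMöbius : (Graph → Graph → ℤ) → Set
IsMöbius μ =
  (∀ a b → a ≅ b → μ a b ≡ 1ℤ) ×
  (∀ a b → ¬ (a ≼ b) → μ a b ≡ 0ℤ) ×
  (∀ a b → a ≺ b → ∀ L → IntervalReps a b L → μ a b ≡ - sumℤ (map (μ a) L))

-- If G is vertex transitive, all vertex-deleted subgraphs G ∖ v are isomorphic, so every proper
-- induced subgraph of G is an induced subgraph of one fixed G ∖ v: the interval [H, G) has the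
-- greatest element G ∖ v. Splitting G ∖ v off the defining sum gives
-- μ(H,G) = − μ(H,G∖v) − Σ_{H ≤ c < G∖v} μ(H,c) = 0, the last sum being − μ(H,G∖v) because
-- H < G ∖ v when |H| < |G| − 1.
-- IsMöbius describes μ only through complete lists of pairwise non-isomorphic representatives.
-- Such a list is filtered out of the induced subgraphs of G only under double negation, which
-- suffices because the goal is a decidable equation in ℤ.

module Submission where

open import Defs
open import Data.Nat using (ℕ; zero; suc; _≤_; _<_; s≤s; s≤s⁻¹)
import Data.Nat.Properties as ℕ
open import Data.Integer using (ℤ; 0ℤ; _+_; -_; _≟_)
import Data.Integer.Properties as ℤ
open import Data.Fin as Fin using (Fin; punchIn; punchOut; fromℕ<)
open import Data.Fin.Properties using (¬Fin0; punchIn-injective; punchIn-punchOut; punchInᵢ≢i; injective⇒≤; all?; any?; ¬∀⟶∃¬)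
open import Data.List using (List; []; _∷_; _++_; map; concatMap; allFin)
open import Data.List.Relation.Unary.All as All using (All; []; _∷_)
open import Data.List.Relation.Unary.All.Properties using (¬Any⇒All¬)
open import Data.List.Relation.Unary.Any as Any using (Any; here; there)
open import Data.List.Relation.Unary.Any.Properties using (concatMap⁺)
open import Data.List.Relation.Unary.AllPairs using (AllPairs; []; _∷_)
open import Data.List.Membership.Propositional using (find; lose)
open import Data.List.Membership.Propositional.Properties using (∈-allFin; ∈-∃++)
open import Data.List.Relation.Binary.Permutation.Propositional using (_↭_; ↭⇒↭ₛ)
open import Data.List.Relation.Binary.Permutation.Propositional.Properties using (All-resp-↭; Any-resp-↭; shift; map⁺)
import Data.List.Relation.Binary.Permutation.Setoid.Properties as Permutationₛ
open import Data.Product using (∃; _×_; _,_; proj₁; proj₂; map₂)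
open import Data.Sum using (_⊎_; inj₁; inj₂)
open import Effect.Monad using (RawMonad)
open import Function using (_∘_; id)
open import Function.Definitions using (Injective; Surjective)
import Function.Construct.Composition as Compose
import Function.Construct.Identity as Identity
import Function.Construct.Symmetry as Symmetry
open import Function.Consequences.Propositional using (strictlySurjective⇒surjective)
open import Level using (0ℓ)
open import Relation.Binary.Definitions using (_Respects_; _Respectsʳ_; _Respectsˡ_)
open import Relation.Binary.PropositionalEquality using (_≡_; _≢_; refl; trans; cong; cong₂; subst; resp₂; setoid; module ≡-Reasoning)
import Relation.Binary.PropositionalEquality as ≡
open import Relation.Nullary using (¬_; Dec; yes; no; contradiction)
open import Relation.Nullary.Decidable using (decidable-stable; ¬¬-excluded-middle)
open import Relation.Nullary.Negation using (¬¬-Monad)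

open RawMonad (¬¬-Monad {0ℓ})

≼-trans : ∀ {A B C} → A ≼ B → B ≼ C → A ≼ C
≼-trans (f , f-inj , f-pres) (g , g-inj , g-pres) =
  g ∘ f , f-inj ∘ g-inj , λ i j → trans (g-pres (f i) (f j)) (f-pres i j)

≅-refl : ∀ {A} → A ≅ A
≅-refl = id , Identity.bijective _≡_ , λ i j → refl

≅-sym : ∀ {A B} → A ≅ B → B ≅ A
≅-sym {A} {B} (f , f-bij@(_ , f-surj) , f-pres) =
  f⁻¹ , Symmetry.bijective f-bij refl ≡.sym trans (cong f) , f⁻¹-pres
  where
  f⁻¹ : Fin ∣ B ∣ → Fin ∣ A ∣
  f⁻¹ y = proj₁ (f-surj y)
  f∘f⁻¹ : ∀ y → f (f⁻¹ y) ≡ y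
  f∘f⁻¹ y = proj₂ (f-surj y) refl
  f⁻¹-pres : Preserves B A f⁻¹
  f⁻¹-pres i j = trans (≡.sym (f-pres (f⁻¹ i) (f⁻¹ j))) (cong₂ (adj B) (f∘f⁻¹ i) (f∘f⁻¹ j))

≅-trans : ∀ {A B C} → A ≅ B → B ≅ C → A ≅ C
≅-trans (f , f-bij , f-pres) (g , g-bij , g-pres) =
  g ∘ f , Compose.bijective _≡_ _≡_ _≡_ f-bij g-bij , λ i j → trans (g-pres (f i) (f j)) (f-pres i j)

≅⇒≼ : ∀ {A B} → A ≅ B → A ≼ B
≅⇒≼ (f , (f-inj , _) , f-pres) = f , f-inj , f-pres

≼-refl : ∀ {A} → A ≼ A
≼-refl {A} = ≅⇒≼ {A} {A} (≅-refl {A})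

≼-respʳ-≅ : _≼_ Respectsʳ _≅_
≼-respʳ-≅ {A} {B} {C} B≅C A≼B = ≼-trans {A} {B} {C} A≼B (≅⇒≼ {B} {C} B≅C)

≼-respˡ-≅ : _≼_ Respectsˡ _≅_
≼-respˡ-≅ {C} {A} {B} A≅B A≼C = ≼-trans {B} {A} {C} (≅⇒≼ {B} {A} (≅-sym {A} {B} A≅B)) A≼C

≺-respʳ-≅ : _≺_ Respectsʳ _≅_
≺-respʳ-≅ {A} {B} {C} B≅C (A≼B , A≇B) =
  ≼-respʳ-≅ {A} {B} {C} B≅C A≼B , λ A≅C → A≇B (≅-trans {A} {C} {B} A≅C (≅-sym {B} {C} B≅C))

≺-respˡ-≅ : _≺_ Respectsˡ _≅_
≺-respˡ-≅ {C} {A} {B} A≅B (A≼C , A≇C) =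
  ≼-respˡ-≅ {C} {A} {B} A≅B A≼C , λ B≅C → A≇C (≅-trans {A} {B} {C} A≅B B≅C)

≼⇒∣≤∣ : ∀ {A B} → A ≼ B → ∣ A ∣ ≤ ∣ B ∣
≼⇒∣≤∣ (_ , f-inj , _) = injective⇒≤ f-inj

≼∧∣<∣⇒≺ : ∀ {A B} → A ≼ B → ∣ A ∣ < ∣ B ∣ → A ≺ B
≼∧∣<∣⇒≺ {A} {B} A≼B ∣A∣<∣B∣ =
  A≼B , λ A≅B → ℕ.<⇒≱ ∣A∣<∣B∣ (≼⇒∣≤∣ {B} {A} (≅⇒≼ {B} {A} (≅-sym {A} {B} A≅B)))

infixl 30 _∖_

_∖_ : (G : Graph) → Fin ∣ G ∣ → Graph
record { n = suc k ; adj = a ; sym = s } ∖ v = record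
  { n = k ; adj = λ i j → a (punchIn v i) (punchIn v j) ; sym = λ i j → s _ _ }

suc-∣∖∣ : ∀ G v → suc ∣ G ∖ v ∣ ≡ ∣ G ∣
suc-∣∖∣ record { n = suc _ } v = refl

∖-≼ : ∀ G v → G ∖ v ≼ G
∖-≼ record { n = suc _ } v = punchIn v , punchIn-injective v _ _ , λ i j → refl

avoiding⇒≼∖ : ∀ {H} G {v} (f : Fin ∣ H ∣ → Fin ∣ G ∣) → Injective _≡_ _≡_ f → Preserves H G f →
              (∀ x → f x ≢ v) → H ≼ G ∖ v
avoiding⇒≼∖ {H} G@record { n = suc k ; adj = a } {v} f f-inj f-pres f≢v = g , g-inj , g-pres
  where
  g : Fin ∣ H ∣ → Fin k
  g x = punchOut (f≢v x ∘ ≡.sym)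
  punchIn∘g : ∀ x → punchIn v (g x) ≡ f x
  punchIn∘g x = punchIn-punchOut _
  g-inj : Injective _≡_ _≡_ g
  g-inj {x} {y} gx≡gy = f-inj (trans (≡.sym (punchIn∘g x)) (trans (cong (punchIn v) gx≡gy) (punchIn∘g y)))
  g-pres : Preserves H (G ∖ v) g
  g-pres i j = trans (cong₂ a (punchIn∘g i) (punchIn∘g j)) (f-pres i j)

surjective-or-avoiding : ∀ {m k} (f : Fin m → Fin k) → Surjective _≡_ _≡_ f ⊎ ∃ λ v → ∀ x → f x ≢ v
surjective-or-avoiding {k = k} f with all? hit? | ¬∀⟶∃¬ k _ hit?
  where hit? = λ v → any? (λ x → f x Fin.≟ v)
... | yes hit | _     = inj₁ (strictlySurjective⇒surjective hit)
... | no ¬hit | avoid = inj₂ (map₂ (λ ¬hitᵥ x fx≡v → ¬hitᵥ (x , fx≡v)) (avoid ¬hit))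

≼⇒≅⊎≼∖ : ∀ {H G} → H ≼ G → H ≅ G ⊎ ∃ λ v → H ≼ G ∖ v
≼⇒≅⊎≼∖ {H} {G} (f , f-inj , f-pres) with surjective-or-avoiding f
... | inj₁ f-surj = inj₁ (f , (f-inj , f-surj) , f-pres)
... | inj₂ (v , f≢v) = inj₂ (v , avoiding⇒≼∖ {H} G f f-inj f-pres f≢v)

vertexTransitive⇒∖≼∖ : ∀ G → VertexTransitive G → ∀ w v → G ∖ w ≼ G ∖ v
vertexTransitive⇒∖≼∖ G@record { n = suc _ } vt w v with vt w v
... | σ , (σ-inj , _) , σ-pres , σw≡v =
  avoiding⇒≼∖ {G ∖ w} G (σ ∘ punchIn w) (punchIn-injective w _ _ ∘ σ-inj) (λ i j → σ-pres _ _)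
    (λ x σx≡v → punchInᵢ≢i w x (σ-inj (trans σx≡v (≡.sym σw≡v))))

vertexTransitive⇒≺⇒≼∖ : ∀ {G} → VertexTransitive G → ∀ v {H} → H ≺ G → H ≼ G ∖ v
vertexTransitive⇒≺⇒≼∖ {G} vt v {H} (H≼G , H≇G) with ≼⇒≅⊎≼∖ {H} {G} H≼G
... | inj₁ H≅G = contradiction H≅G H≇G
... | inj₂ (w , H≼G∖w) = ≼-trans {H} {G ∖ w} {G ∖ v} H≼G∖w (vertexTransitive⇒∖≼∖ G vt w v)

inducedSubgraphsWithin : ℕ → Graph → List Graph
inducedSubgraphsWithin zero    G = G ∷ []
inducedSubgraphsWithin (suc k) G = G ∷ concatMap (λ v → inducedSubgraphsWithin k (G ∖ v)) (allFin ∣ G ∣)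

inducedSubgraphs : Graph → List Graph
inducedSubgraphs G = inducedSubgraphsWithin ∣ G ∣ G

inducedSubgraphsWithin-complete : ∀ k {H G} → ∣ G ∣ ≡ k → H ≼ G → Any (H ≅_) (inducedSubgraphsWithin k G)
inducedSubgraphsWithin-complete zero {H} {G} ∣G∣≡0 H≼G with ≼⇒≅⊎≼∖ {H} {G} H≼G
... | inj₁ H≅G     = here H≅G
... | inj₂ (v , _) = contradiction (subst Fin ∣G∣≡0 v) ¬Fin0
inducedSubgraphsWithin-complete (suc k) {H} {G} ∣G∣≡1+k H≼G with ≼⇒≅⊎≼∖ {H} {G} H≼G
... | inj₁ H≅G         = here H≅G
... | inj₂ (v , H≼G∖v) = there (concatMap⁺ (λ w → inducedSubgraphsWithin k (G ∖ w)) (lose (∈-allFin v)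
  (inducedSubgraphsWithin-complete k {H} {G ∖ v} (ℕ.suc-injective (trans (suc-∣∖∣ G v) ∣G∣≡1+k)) H≼G∖v)))

inducedSubgraphs-complete : ∀ {H G} → H ≼ G → Any (H ≅_) (inducedSubgraphs G)
inducedSubgraphs-complete {H} {G} = inducedSubgraphsWithin-complete ∣ G ∣ {H} {G} refl

Transversal : (Graph → Set) → List Graph → List Graph → Set
Transversal P C L = All P L × All (λ c → P c → Any (c ≅_) L) C × AllPairs (λ x y → ¬ x ≅ y) L

transversal-∷ : ∀ {P C L} c → Transversal P C L → Dec (P c) → Dec (Any (c ≅_) L) → ∃ (Transversal P (c ∷ C))
transversal-∷ c (PL , covers , distinct) (no ¬Pc) _ =
  _ , PL , (λ Pc → contradiction Pc ¬Pc) ∷ covers , distinct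
transversal-∷ c (PL , covers , distinct) (yes _) (yes c∈L) =
  _ , PL , (λ _ → c∈L) ∷ covers , distinct
transversal-∷ c (PL , covers , distinct) (yes Pc) (no c∉L) =
  _ , Pc ∷ PL , (λ _ → here (≅-refl {c})) ∷ All.map (there ∘_) covers , ¬Any⇒All¬ _ c∉L ∷ distinct

¬¬-transversal : ∀ P C → ¬ ¬ ∃ (Transversal P C)
¬¬-transversal P []      = pure ([] , [] , [] , [])
¬¬-transversal P (c ∷ C) = do
  (L , T) ← ¬¬-transversal P C
  Pc? ← ¬¬-excluded-middle
  c∈L? ← ¬¬-excluded-middle
  pure (transversal-∷ c T Pc? c∈L?)

¬¬-intervalReps : ∀ a b → ¬ ¬ ∃ (IntervalReps a b)
¬¬-intervalReps a b = do
  (L , inInterval , covers , distinct) ← ¬¬-transversal (λ c → a ≼ c × c ≺ b) (inducedSubgraphs b)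
  pure (L , inInterval , complete covers , distinct)
  where
  complete : ∀ {L} → All (λ c → a ≼ c × c ≺ b → Any (c ≅_) L) (inducedSubgraphs b) →
             ∀ c → a ≼ c → c ≺ b → Any (c ≅_) L
  complete covers c a≼c c≺b with find (inducedSubgraphs-complete {c} {b} (proj₁ c≺b))
  ... | x , x∈ , c≅x = Any.map (λ {y} → ≅-trans {c} {x} {y} c≅x)
    (All.lookup covers x∈ (≼-respʳ-≅ {a} {c} {x} c≅x a≼c , ≺-respˡ-≅ {b} {c} {x} c≅x c≺b))

intervalReps-resp-↭ : ∀ {a b} → IntervalReps a b Respects _↭_
intervalReps-resp-↭ {a} {b} p (inInterval , covers , distinct) =
  All-resp-↭ p inInterval ,
  (λ c a≼c c≺b → Any-resp-↭ p (covers c a≼c c≺b)) ,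
  AllPairs-resp-↭ (λ {x} {y} x≇y y≅x → x≇y (≅-sym {y} {x} y≅x)) (resp₂ _) (↭⇒↭ₛ p) distinct
  where open Permutationₛ (setoid Graph) using (AllPairs-resp-↭)

IsGreatestBelow : Graph → Graph → Set
IsGreatestBelow m b = ∀ c → (c ≺ b → c ≼ m) × (c ≼ m → c ≺ b)

isGreatestBelow-resp-≅ : ∀ {b} → (λ m → IsGreatestBelow m b) Respects _≅_
isGreatestBelow-resp-≅ {b} {m} {m'} m≅m' greatest c =
  ≼-respʳ-≅ {c} {m} {m'} m≅m' ∘ proj₁ (greatest c) ,
  proj₂ (greatest c) ∘ ≼-respʳ-≅ {c} {m'} {m} (≅-sym {m} {m'} m≅m')

intervalReps-∷ : ∀ {a b m L} → IsGreatestBelow m b → IntervalReps a b (m ∷ L) → IntervalReps a m L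
intervalReps-∷ {a} {b} {m} greatest (_ ∷ inInterval , covers , m≇L ∷ distinct) =
  All.zipWith (λ { {c} ((a≼c , c≺b) , m≇c) → a≼c , proj₁ (greatest c) c≺b , m≇c ∘ ≅-sym {c} {m} })
    (inInterval , m≇L) ,
  (λ c a≼c (c≼m , c≇m) → Any.tail c≇m (covers c a≼c (proj₂ (greatest c) c≼m))) ,
  distinct

sumℤ-↭ : ∀ {xs ys} → xs ↭ ys → sumℤ xs ≡ sumℤ ys
sumℤ-↭ p = foldr-commMonoid ℤ.+-0-isCommutativeMonoid (↭⇒↭ₛ p)
  where open Permutationₛ (setoid ℤ) using (foldr-commMonoid)

μ≡0-belowGreatest : ∀ {μ} → IsMöbius μ → ∀ {a m b L} → IsGreatestBelow m b → a ≺ m → IntervalReps a b L → μ a b ≡ 0ℤ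
μ≡0-belowGreatest {μ} (_ , _ , μ-≺) {a} {m} {b} greatest a≺m reps@(_ , covers , _)
  with m' , m'∈L , m≅m' ← find (covers m (proj₁ a≺m) (proj₂ (greatest m) (≼-refl {m})))
  with pre , post , refl ← ∈-∃++ m'∈L = begin
    μ a b                    ≡⟨ μ-≺ a b (proj₂ (greatest a) (proj₁ a≺m)) _ reps ⟩
    - sumℤ (map (μ a) L)     ≡⟨ cong -_ (sumℤ-↭ (map⁺ (μ a) (shift m' pre post))) ⟩
    - (μ a m' + Σ′)          ≡⟨ cong (λ x → - (x + Σ′)) (μ-≺ a m' a≺m' L′ repsₘ′) ⟩
    - (- Σ′ + Σ′)            ≡⟨ cong -_ (ℤ.+-inverseˡ Σ′) ⟩
    0ℤ                       ∎
  where
  open ≡-Reasoning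
  L = pre ++ m' ∷ post
  L′ = pre ++ post
  Σ′ = sumℤ (map (μ a) L′)
  a≺m' : a ≺ m'
  a≺m' = ≺-respʳ-≅ {a} {m} {m'} m≅m' a≺m
  repsₘ′ : IntervalReps a m' L′
  repsₘ′ = intervalReps-∷ {a} {b} {m'} (isGreatestBelow-resp-≅ {b} {m} {m'} m≅m' greatest)
             (intervalReps-resp-↭ {a} {b} (shift m' pre post) reps)

≼∖⇒≺ : ∀ G v {H} → H ≼ G ∖ v → H ≺ G
≼∖⇒≺ G v {H} H≼G∖v = ≼∧∣<∣⇒≺ {H} {G} (≼-trans {H} {G ∖ v} {G} H≼G∖v (∖-≼ G v))
  (subst (∣ H ∣ <_) (suc-∣∖∣ G v) (s≤s (≼⇒∣≤∣ {H} {G ∖ v} H≼G∖v)))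

vertexTransitive⇒isGreatestBelow∖ : ∀ {G} → VertexTransitive G → ∀ v → IsGreatestBelow (G ∖ v) G
vertexTransitive⇒isGreatestBelow∖ {G} vt v H = vertexTransitive⇒≺⇒≼∖ vt v {H} , ≼∖⇒≺ G v {H}

proposition3p4 : (μ : Graph → Graph → ℤ) → IsMöbius μ →
    (G : Graph) → VertexTransitive G →
    (H : Graph) → suc ∣ H ∣ < ∣ G ∣ → μ H G ≡ 0ℤ
proposition3p4 μ isMöbius G vt H 1+∣H∣<∣G∣ = decidable-stable (μ H G ≟ 0ℤ) do
  yes H≼G ← ¬¬-excluded-middle
    where no H⋠G → pure (proj₁ (proj₂ isMöbius) H G H⋠G)
  (L , reps) ← ¬¬-intervalReps H G
  pure (μ≡0-belowGreatest isMöbius {H} {G ∖ v} {G} greatest (H≺G∖v H≼G) reps)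
  where
  v : Fin ∣ G ∣
  v = fromℕ< (ℕ.m<n⇒0<n 1+∣H∣<∣G∣)
  greatest : IsGreatestBelow (G ∖ v) G
  greatest = vertexTransitive⇒isGreatestBelow∖ vt v
  H≺G∖v : H ≼ G → H ≺ G ∖ v
  H≺G∖v H≼G = ≼∧∣<∣⇒≺ {H} {G ∖ v}
    (proj₁ (greatest H) (≼∧∣<∣⇒≺ {H} {G} H≼G (ℕ.<-trans (ℕ.n<1+n _) 1+∣H∣<∣G∣)))
    (s≤s⁻¹ (subst (suc ∣ H ∣ <_) (≡.sym (suc-∣∖∣ G v)) 1+∣H∣<∣G∣))
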